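{- Let $p$ be the mesh pattern $(12,R)$ with $R=\{(0,0),(0,1),(0,2),(2,0),(2,1),(2,2)\}$, and let $A_n=|K_n|$. For every $n\ge2$, exactly $A_n/2$ king permutations of length $n$ avoid $p$, and exactly $A_n/2$ king permutations of length $n$ contain exactly one occurrence of $p$.
   Context: A permutation $\sigma=\sigma_1\cdots\sigma_n$ of $\{1,\dots,n\}$ is a king permutation if $|\sigma_{i+1}-\sigma_i|>1$ for all $1\le i\le n-1$; $K_n$ is the set of king permutations of length $n$. For a mesh pattern $p=(12,R)$ with $R\subseteq\{0,1,2\}^2$, an occurrence of $p$ in $\sigma\in S_n$ is a pair of positions $i_1<i_2$ with $\sigma_{i_1}<\sigma_{i_2}$ such that for every $(x,y)\in R$ there is no position $m$ with $i_x<m<i_{x+1}$ and $v_y<\sigma_m<v_{y+1}$, where $i_0=0$, $i_3=n+1$, $v_0=0$, $v_1=\sigma_{i_1}$, $v_2=\sigma_{i_2}$, $v_3=n+1$ (first coordinate of a box indexes positions, second values). $\sigma$ avoids $p$ if it has no occurrence of $p$. -}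

module Defs where

open import Data.Nat using (ℕ; zero; suc; _<_; _≤_; _+_; _*_)
open import Data.Nat.Properties using (_<?_)
open import Data.Fin using (Fin; toℕ; fromℕ<)
open import Data.Vec using (Vec; lookup)
open import Data.Product using (_×_; _,_; Σ; ∃)
open import Data.List using (List; length; filter; allFin; cartesianProduct)
open import Data.List.Membership.Propositional using (_∈_)
open import Data.List.Relation.Unary.Unique.Propositional using (Unique)
open import Data.Sum using (_⊎_)
open import Relation.Nullary using (¬_; Dec; yes; no)
open import Relation.Binary.PropositionalEquality using (_≡_)
open import Function.Definitions using (Injective)
open import Function.Bundles using (_⇔_)

-- A permutation of {1..n} is represented as its one-line notation: a vector
-- σ of length n with entries in Fin n (value k stands for k+1), injective.
IsPerm : {n : ℕ} → Vec (Fin n) n → Set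
IsPerm {n} σ = Injective _≡_ _≡_ (lookup σ)

-- values as natural numbers 1..n, positions 1..n
val : {n : ℕ} → Vec (Fin n) n → ℕ → ℕ
val {n} σ zero = zero
val {n} σ (suc j) with j <? n
... | yes j<n = suc (toℕ (lookup σ (fromℕ< j<n)))
... | no _ = zero

-- king permutation: |σ_{i+1} - σ_i| > 1 for all consecutive positions
-- (equivalently σ_{i+1} ≠ σ_i ± 1, written without subtraction)
IsKing : {n : ℕ} → Vec (Fin n) n → Set
IsKing {n} σ = ∀ (i : ℕ) → 1 ≤ i → suc i ≤ n →
  ¬ (val σ (suc i) ≡ suc (val σ i)) × ¬ (val σ i ≡ suc (val σ (suc i)))

King : (n : ℕ) → Vec (Fin n) n → Set
King n σ = IsPerm σ × IsKing σ

-- Boxes (0,y) for y = 0,1,2 cover the whole column strip of positions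
-- m < i₁ (all values 0 < σ_m < n+1 except the values v₁,v₂ themselves,
-- which are taken at i₁,i₂ by injectivity); likewise (2,y) covers all
-- positions m > i₂.  We nevertheless state the definition literally, box by box.
data Box : Set where
  b0 b1 b2 : Box

Occ : {n : ℕ} → Vec (Fin n) n → ℕ → ℕ → Set
Occ {n} σ i₁ i₂ =
  (1 ≤ i₁) × (i₁ < i₂) × (i₂ ≤ n) × (val σ i₁ < val σ i₂) ×
  (∀ (x y : Box) → (x ≡ b0 ⊎ x ≡ b2) →
     ¬ (∃ λ m → (pos x 0 < m) × (m < pos x 1) ×
                 (vv y 0 < val σ m) × (val σ m < vv y 1)))
  where
  ix : ℕ → ℕ
  ix 0 = 0
  ix 1 = i₁
  ix 2 = i₂
  ix _ = suc n
  vx : ℕ → ℕ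
  vx 0 = 0
  vx 1 = val σ i₁
  vx 2 = val σ i₂
  vx _ = suc n
  idx : Box → ℕ
  idx b0 = 0
  idx b1 = 1
  idx b2 = 2
  -- pos x k = i_{x+k}, vv y k = v_{y+k}
  pos : Box → ℕ → ℕ
  pos x k = ix (idx x + k)
  vv : Box → ℕ → ℕ
  vv y k = vx (idx y + k)

Avoids : {n : ℕ} → Vec (Fin n) n → Set
Avoids σ = ¬ (∃ λ i₁ → ∃ λ i₂ → Occ σ i₁ i₂)

ExactlyOneOcc : {n : ℕ} → Vec (Fin n) n → Set
ExactlyOneOcc σ = ∃ λ i₁ → ∃ λ i₂ → Occ σ i₁ i₂ ×
  (∀ j₁ j₂ → Occ σ j₁ j₂ → (j₁ ≡ i₁) × (j₂ ≡ i₂))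

HasCard : {A : Set} → (A → Set) → ℕ → Set
HasCard {A} P k = Σ (List A) λ L → Unique L × (∀ x → x ∈ L ⇔ P x) × (length L ≡ k)

{-# OPTIONS --safe #-}
module Submission where

-- The shaded boxes of p fill the whole vertical strips left of the 1 and
-- right of the 2, so in a permutation an occurrence at positions i₁ < i₂
-- leaves no entry before i₁ or after i₂: it must be (1, n).  Hence σ contains
-- p exactly once when σ₁ < σₙ and avoids it otherwise.  Reversal is an
-- involution of Kₙ exchanging σ₁ < σₙ and σ₁ > σₙ, so each class has Aₙ/2
-- elements.

open import Defs
open import Data.Nat using (ℕ; zero; suc; _+_; _*_; _∸_; _≤_; _<_; z≤n; s≤s; z<s; _≤?_)
open import Data.Nat.Properties
  using (_<?_; _≟_; <-cmp; <-asym; <-trans; <⇒≤; <⇒≢; ≤⇒≯; ≮⇒≥; ≤∧≢⇒<; ≤-refl; ≤-trans;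
         ≤-antisym; suc-injective; n∸n≡0; ∸-monoʳ-<; +-∸-assoc; *-suc; *-identityʳ;
         allUpTo?)
open import Data.Nat.DivMod using (_/_; m*n/n≡m)
open import Data.Fin using (Fin; toℕ; fromℕ<; opposite)
open import Data.Fin.Properties
  using (toℕ-injective; toℕ<n; fromℕ<-toℕ; toℕ-fromℕ<; opposite-prop; opposite-involutive; all?)
  renaming (_≟_ to _≟ᶠ_)
open import Data.Vec using (Vec; []; _∷_; lookup; tabulate)
open import Data.Vec.Properties using (lookup∘tabulate; tabulate∘lookup; tabulate-cong; ∷-injective)
open import Data.List as List using (List; length; filter; cartesianProduct; _++_)
open import Data.List.Properties using (length-map; length-++)
open import Data.List.Membership.Propositional using (_∈_)
open import Data.List.Membership.Propositional.Properties
  using (∈-map⁺; ∈-map⁻; ∈-++⁺ˡ; ∈-++⁺ʳ; ∈-++⁻; ∈-filter⁺; ∈-filter⁻; ∈-cartesianProduct⁺; ∈-allFin)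
open import Data.List.Relation.Unary.All using ([])
open import Data.List.Relation.Unary.Any using (here)
open import Data.List.Relation.Unary.Unique.Propositional using (Unique; []; _∷_)
import Data.List.Relation.Unary.Unique.Propositional.Properties as Unique
open import Data.Product using (_×_; _,_; proj₁; proj₂; Σ; uncurry; swap)
open import Data.Sum using (_⊎_; inj₁; inj₂)
open import Function using (_∘_)
open import Function.Bundles using (_⇔_; mk⇔; Equivalence)
open import Function.Properties.Equivalence using () renaming (sym to ⇔-sym)
open import Relation.Nullary using (¬_; yes; no; contradiction)
open import Relation.Nullary.Decidable using (map′; _×-dec_; _→-dec_; ¬?)
open import Relation.Unary using (Decidable)
open import Relation.Binary.Definitions using (tri<; tri≈; tri>)
open import Relation.Binary.PropositionalEquality
  using (_≡_; _≢_; refl; sym; trans; cong; cong₂; subst; subst₂; module ≡-Reasoning)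

open Equivalence using (to; from)

HasCard-resp : {A : Set} {P Q : A → Set} {k : ℕ} →
               (∀ x → P x ⇔ Q x) → HasCard P k → HasCard Q k
HasCard-resp P⇔Q (xs , unique , ∈⇔P , length≡k) =
  xs , unique , (λ x → mk⇔ (to (P⇔Q x) ∘ to (∈⇔P x)) (from (∈⇔P x) ∘ from (P⇔Q x))) , length≡k

×-⇔-under : {P Q R : Set} → (P → Q ⇔ R) → (P × Q) ⇔ (P × R)
×-⇔-under Q⇔R = mk⇔ (λ (p , q) → p , to (Q⇔R p) q) (λ (p , r) → p , from (Q⇔R p) r)

[m+m]/2≡m : ∀ m → (m + m) / 2 ≡ m
[m+m]/2≡m m = begin
  (m + m) / 2     ≡⟨ cong (λ k → (m + k) / 2) (*-identityʳ m) ⟨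
  (m + m * 1) / 2 ≡⟨ cong (_/ 2) (*-suc m 1) ⟨
  m * 2 / 2       ≡⟨ m*n/n≡m m 2 ⟩
  m               ∎
  where open ≡-Reasoning

vectors : {A : Set} → List A → (k : ℕ) → List (Vec A k)
vectors xs zero    = List.[ [] ]
vectors xs (suc k) = List.map (uncurry _∷_) (cartesianProduct xs (vectors xs k))

vectors-unique : {A : Set} {xs : List A} → Unique xs → (k : ℕ) → Unique (vectors xs k)
vectors-unique xs-unique zero    = [] ∷ []
vectors-unique xs-unique (suc k) =
  Unique.map⁺ (uncurry (cong₂ _,_) ∘ ∷-injective)
              (Unique.cartesianProduct⁺ xs-unique (vectors-unique xs-unique k))

∈-vectors : {A : Set} {xs : List A} → (∀ x → x ∈ xs) → {k : ℕ} (v : Vec A k) → v ∈ vectors xs k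
∈-vectors xs-complete []       = here refl
∈-vectors xs-complete (x ∷ v) =
  ∈-map⁺ (uncurry _∷_) (∈-cartesianProduct⁺ (xs-complete x) (∈-vectors xs-complete v))

module Halving {A : Set} {xs : List A} (xs-unique : Unique xs) (xs-complete : ∀ x → x ∈ xs)
               {P Q : A → Set} (P? : Decidable P) (Q? : Decidable Q)
               (r : A → A) (r-involutive : ∀ x → r (r x) ≡ x)
               (r-preserves : ∀ {x} → P x → P (r x))
               (r-swaps : ∀ {x} → P x → Q (r x) ⇔ (¬ Q x)) where

  P×Q? : Decidable (λ x → P x × Q x)
  P×Q? x = P? x ×-dec Q? x

  withQ withoutQ : List A
  withQ    = filter P×Q? xs
  withoutQ = List.map r withQ

  half : ℕ
  half = length withQ

  ∈-withQ : ∀ x → x ∈ withQ ⇔ (P x × Q x)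
  ∈-withQ x = mk⇔ (proj₂ ∘ ∈-filter⁻ P×Q? {xs = xs}) (∈-filter⁺ P×Q? (xs-complete x))

  ∈-withoutQ : ∀ x → x ∈ withoutQ ⇔ (P x × ¬ Q x)
  ∈-withoutQ x = mk⇔ into (subst (_∈ withoutQ) (r-involutive x) ∘ ∈-map⁺ r ∘ back)
    where
    into : x ∈ withoutQ → P x × ¬ Q x
    into x∈ with ∈-map⁻ r x∈
    ... | y , y∈ , refl with to (∈-withQ y) y∈
    ...   | Py , Qy = r-preserves Py , λ Qry → to (r-swaps Py) Qry Qy
    back : P x × ¬ Q x → r x ∈ withQ
    back (Px , ¬Qx) = from (∈-withQ (r x)) (r-preserves Px , from (r-swaps Px) ¬Qx)

  withQ-unique : Unique withQ
  withQ-unique = Unique.filter⁺ P×Q? xs-unique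

  withoutQ-unique : Unique withoutQ
  withoutQ-unique = Unique.map⁺ r-injective withQ-unique
    where
    r-injective : ∀ {x y} → r x ≡ r y → x ≡ y
    r-injective {x} {y} eq = trans (sym (r-involutive x)) (trans (cong r eq) (r-involutive y))

  card : HasCard P (half + half)
  card = withQ ++ withoutQ
       , Unique.++⁺ withQ-unique withoutQ-unique
           (λ (∈with , ∈without) → proj₂ (to (∈-withoutQ _) ∈without) (proj₂ (to (∈-withQ _) ∈with)))
       , (λ x → mk⇔ (into x) (back x))
       , trans (length-++ withQ) (cong (half +_) (length-map r withQ))
    where
    into : ∀ x → x ∈ withQ ++ withoutQ → P x
    into x ∈both with ∈-++⁻ withQ ∈both
    ... | inj₁ ∈with    = proj₁ (to (∈-withQ x) ∈with)
    ... | inj₂ ∈without = proj₁ (to (∈-withoutQ x) ∈without)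
    back : ∀ x → P x → x ∈ withQ ++ withoutQ
    back x Px with Q? x
    ... | yes Qx = ∈-++⁺ˡ (from (∈-withQ x) (Px , Qx))
    ... | no ¬Qx = ∈-++⁺ʳ withQ (from (∈-withoutQ x) (Px , ¬Qx))

  card-Q : HasCard (λ x → P x × Q x) half
  card-Q = withQ , withQ-unique , ∈-withQ , refl

  card-¬Q : HasCard (λ x → P x × ¬ Q x) half
  card-¬Q = withoutQ , withoutQ-unique , ∈-withoutQ , length-map r withQ

val-suc-toℕ : {n : ℕ} (σ : Vec (Fin n) n) (i : Fin n) →
              val σ (suc (toℕ i)) ≡ suc (toℕ (lookup σ i))
val-suc-toℕ {n} σ i with toℕ i <? n
... | yes i<n = cong (λ j → suc (toℕ (lookup σ j))) (fromℕ<-toℕ i i<n)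
... | no  i≮n = contradiction (toℕ<n i) i≮n

val-suc : {n k : ℕ} (σ : Vec (Fin n) n) (k<n : k < n) →
          val σ (suc k) ≡ suc (toℕ (lookup σ (fromℕ< k<n)))
val-suc σ k<n =
  trans (cong (λ j → val σ (suc j)) (sym (toℕ-fromℕ< k<n))) (val-suc-toℕ σ (fromℕ< k<n))

val-bounds : {n a : ℕ} (σ : Vec (Fin n) n) → 1 ≤ a → a ≤ n → 0 < val σ a × val σ a < suc n
val-bounds {a = suc k} σ _ k<n rewrite val-suc σ k<n = z<s , s≤s (toℕ<n _)

val-injective : {n a b : ℕ} (σ : Vec (Fin n) n) → IsPerm σ →
                1 ≤ a → a ≤ n → 1 ≤ b → b ≤ n → val σ a ≡ val σ b → a ≡ b
val-injective {a = suc i} {suc j} σ perm (s≤s z≤n) i<n (s≤s z≤n) j<n eq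
  rewrite val-suc σ i<n | val-suc σ j<n = cong suc (begin
    i                 ≡⟨ toℕ-fromℕ< i<n ⟨
    toℕ (fromℕ< i<n) ≡⟨ cong toℕ (perm (toℕ-injective (suc-injective eq))) ⟩
    toℕ (fromℕ< j<n) ≡⟨ toℕ-fromℕ< j<n ⟩
    j                 ∎)
  where open ≡-Reasoning

FirstBelowLast : {n : ℕ} → Vec (Fin n) n → Set
FirstBelowLast {n} σ = val σ 1 < val σ n

FirstBelowLast? : {n : ℕ} → Decidable (FirstBelowLast {n})
FirstBelowLast? {n} σ = val σ 1 <? val σ n

bands : {lo x y hi v : ℕ} → lo < v → v < hi → v ≢ x → v ≢ y →
        (lo < v × v < x) ⊎ (x < v × v < y) ⊎ (y < v × v < hi)
bands {x = x} {y} {v = v} lo<v v<hi v≢x v≢y with <-cmp v x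
... | tri< v<x _ _ = inj₁ (lo<v , v<x)
... | tri≈ _ v≡x _ = contradiction v≡x v≢x
... | tri> _ _ x<v with <-cmp v y
...   | tri< v<y _ _ = inj₂ (inj₁ (x<v , v<y))
...   | tri≈ _ v≡y _ = contradiction v≡y v≢y
...   | tri> _ _ y<v = inj₂ (inj₂ (y<v , v<hi))

occurrence-at-ends : {n i₁ i₂ : ℕ} (σ : Vec (Fin n) n) → IsPerm σ →
                     Occ σ i₁ i₂ → i₁ ≡ 1 × i₂ ≡ n
occurrence-at-ends {n} {i₁} {i₂} σ perm (1≤i₁ , i₁<i₂ , i₂≤n , _ , shaded) =
  ≤-antisym (≮⇒≥ (left-strip-empty ≤-refl)) 1≤i₁ ,
  ≤-antisym i₂≤n (≮⇒≥ (λ i₂<n → right-strip-empty i₂<n ≤-refl))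
  where
  i₁≤n : i₁ ≤ n
  i₁≤n = ≤-trans (<⇒≤ i₁<i₂) i₂≤n
  1≤i₂ : 1 ≤ i₂
  1≤i₂ = ≤-trans 1≤i₁ (<⇒≤ i₁<i₂)
  value-bands : ∀ {m} → 1 ≤ m → m ≤ n → m ≢ i₁ → m ≢ i₂ →
                (0 < val σ m × val σ m < val σ i₁) ⊎
                (val σ i₁ < val σ m × val σ m < val σ i₂) ⊎
                (val σ i₂ < val σ m × val σ m < suc n)
  value-bands 1≤m m≤n m≢i₁ m≢i₂ =
    bands (proj₁ (val-bounds σ 1≤m m≤n)) (proj₂ (val-bounds σ 1≤m m≤n))
          (m≢i₁ ∘ val-injective σ perm 1≤m m≤n 1≤i₁ i₁≤n)
          (m≢i₂ ∘ val-injective σ perm 1≤m m≤n 1≤i₂ i₂≤n)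
  left-strip-empty : ∀ {m} → 1 ≤ m → ¬ m < i₁
  left-strip-empty {m} 1≤m m<i₁
    with value-bands 1≤m (≤-trans (<⇒≤ m<i₁) i₁≤n) (<⇒≢ m<i₁) (<⇒≢ (<-trans m<i₁ i₁<i₂))
  ... | inj₁ band        = shaded b0 b0 (inj₁ refl) (m , 1≤m , m<i₁ , band)
  ... | inj₂ (inj₁ band) = shaded b0 b1 (inj₁ refl) (m , 1≤m , m<i₁ , band)
  ... | inj₂ (inj₂ band) = shaded b0 b2 (inj₁ refl) (m , 1≤m , m<i₁ , band)
  right-strip-empty : ∀ {m} → i₂ < m → ¬ m ≤ n
  right-strip-empty {m} i₂<m m≤n
    with value-bands (≤-trans 1≤i₂ (<⇒≤ i₂<m)) m≤n (<⇒≢ (<-trans i₁<i₂ i₂<m) ∘ sym) (<⇒≢ i₂<m ∘ sym)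
  ... | inj₁ band        = shaded b2 b0 (inj₂ refl) (m , i₂<m , s≤s m≤n , band)
  ... | inj₂ (inj₁ band) = shaded b2 b1 (inj₂ refl) (m , i₂<m , s≤s m≤n , band)
  ... | inj₂ (inj₂ band) = shaded b2 b2 (inj₂ refl) (m , i₂<m , s≤s m≤n , band)

ends-occurrence : {n : ℕ} (σ : Vec (Fin n) n) → 1 < n → FirstBelowLast σ → Occ σ 1 n
ends-occurrence {n} σ 1<n first<last = ≤-refl , 1<n , ≤-refl , first<last , λ
  { _ _ (inj₁ refl) (_ , s≤s z≤n , s≤s () , _)
  ; _ _ (inj₂ refl) (m , n<m , s≤s m≤n , _) → ≤⇒≯ m≤n n<m }

occurrence⇒FirstBelowLast : {n i₁ i₂ : ℕ} (σ : Vec (Fin n) n) → IsPerm σ →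
                            Occ σ i₁ i₂ → FirstBelowLast σ
occurrence⇒FirstBelowLast σ perm occ@(_ , _ , _ , v₁<v₂ , _) with occurrence-at-ends σ perm occ
... | refl , refl = v₁<v₂

Avoids⇔¬FirstBelowLast : {n : ℕ} (σ : Vec (Fin n) n) → IsPerm σ → 1 < n →
                         Avoids σ ⇔ (¬ FirstBelowLast σ)
Avoids⇔¬FirstBelowLast {n} σ perm 1<n = mk⇔ into back
  where
  into : Avoids σ → ¬ FirstBelowLast σ
  into avoids first<last = avoids (1 , n , ends-occurrence σ 1<n first<last)
  back : ¬ FirstBelowLast σ → Avoids σ
  back first≮last (_ , _ , occ) = first≮last (occurrence⇒FirstBelowLast σ perm occ)

ExactlyOneOcc⇔FirstBelowLast : {n : ℕ} (σ : Vec (Fin n) n) → IsPerm σ → 1 < n →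
                               ExactlyOneOcc σ ⇔ FirstBelowLast σ
ExactlyOneOcc⇔FirstBelowLast {n} σ perm 1<n = mk⇔ into back
  where
  into : ExactlyOneOcc σ → FirstBelowLast σ
  into (_ , _ , occ , _) = occurrence⇒FirstBelowLast σ perm occ
  back : FirstBelowLast σ → ExactlyOneOcc σ
  back first<last = 1 , n , ends-occurrence σ 1<n first<last , λ _ _ → occurrence-at-ends σ perm

reverse : {n : ℕ} → Vec (Fin n) n → Vec (Fin n) n
reverse σ = tabulate (lookup σ ∘ opposite)

lookup-reverse : {n : ℕ} (σ : Vec (Fin n) n) (i : Fin n) →
                 lookup (reverse σ) i ≡ lookup σ (opposite i)
lookup-reverse σ = lookup∘tabulate (lookup σ ∘ opposite)

reverse-involutive : {n : ℕ} (σ : Vec (Fin n) n) → reverse (reverse σ) ≡ σ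
reverse-involutive σ = trans
  (tabulate-cong (λ i → trans (lookup-reverse σ (opposite i)) (cong (lookup σ) (opposite-involutive i))))
  (tabulate∘lookup σ)

reverse-IsPerm : {n : ℕ} (σ : Vec (Fin n) n) → IsPerm σ → IsPerm (reverse σ)
reverse-IsPerm σ perm {i} {j} eq = begin
  i                       ≡⟨ opposite-involutive i ⟨
  opposite (opposite i)   ≡⟨ cong opposite (perm (begin
    lookup σ (opposite i)   ≡⟨ lookup-reverse σ i ⟨
    lookup (reverse σ) i    ≡⟨ eq ⟩
    lookup (reverse σ) j    ≡⟨ lookup-reverse σ j ⟩
    lookup σ (opposite j)   ∎)) ⟩
  opposite (opposite j)   ≡⟨ opposite-involutive j ⟩
  j                       ∎
  where open ≡-Reasoning

val-reverse : {n i : ℕ} (σ : Vec (Fin n) n) (i<n : i < n) →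
              val (reverse σ) (suc i) ≡ val σ (suc (n ∸ suc i))
val-reverse {n} {i} σ i<n = begin
  val (reverse σ) (suc i)                              ≡⟨ val-suc (reverse σ) i<n ⟩
  suc (toℕ (lookup (reverse σ) (fromℕ< i<n)))          ≡⟨ cong (suc ∘ toℕ) (lookup-reverse σ _) ⟩
  suc (toℕ (lookup σ (opposite (fromℕ< i<n))))         ≡⟨ val-suc-toℕ σ _ ⟨
  val σ (suc (toℕ (opposite (fromℕ< i<n))))            ≡⟨ cong (val σ ∘ suc) (opposite-prop _) ⟩
  val σ (suc (n ∸ suc (toℕ (fromℕ< i<n))))             ≡⟨ cong (λ k → val σ (suc (n ∸ suc k))) (toℕ-fromℕ< i<n) ⟩
  val σ (suc (n ∸ suc i))                              ∎
  where open ≡-Reasoning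

reverse-IsKing : {n : ℕ} (σ : Vec (Fin n) n) → IsKing σ → IsKing (reverse σ)
-- Positions j+1, j+2 of reverse σ are positions t+2, t+1 of σ, so the two
-- conditions of IsKing trade places.
reverse-IsKing {n} σ king (suc j) _ j+1<n
  rewrite val-reverse σ (<⇒≤ j+1<n) | val-reverse σ j+1<n | +-∸-assoc 1 j+1<n =
  swap (king (suc t) z<s t+1<n)
  where
  t : ℕ
  t = n ∸ suc (suc j)
  mirror : n ∸ suc j ≡ suc t
  mirror = +-∸-assoc 1 j+1<n
  t+1<n : suc t < n
  t+1<n = subst (_< n) mirror (∸-monoʳ-< z<s (<⇒≤ j+1<n))

reverse-King : {n : ℕ} {σ : Vec (Fin n) n} → King n σ → King n (reverse σ)
reverse-King {σ = σ} (perm , king) = reverse-IsPerm σ perm , reverse-IsKing σ king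

reverse-FirstBelowLast : {n : ℕ} (σ : Vec (Fin n) n) → IsPerm σ → 1 < n →
                         FirstBelowLast (reverse σ) ⇔ (¬ FirstBelowLast σ)
reverse-FirstBelowLast {suc m} σ perm 1<n = mk⇔ into back
  where
  first : val (reverse σ) 1 ≡ val σ (suc m)
  first = val-reverse σ z<s
  last : val (reverse σ) (suc m) ≡ val σ 1
  last = trans (val-reverse σ ≤-refl) (cong (val σ ∘ suc) (n∸n≡0 m))
  ends-differ : val σ (suc m) ≢ val σ 1
  ends-differ = <⇒≢ 1<n ∘ sym ∘ val-injective σ perm (<⇒≤ 1<n) ≤-refl ≤-refl (<⇒≤ 1<n)
  into : FirstBelowLast (reverse σ) → ¬ FirstBelowLast σ
  into = <-asym ∘ subst₂ _<_ first last
  back : ¬ FirstBelowLast σ → FirstBelowLast (reverse σ)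
  back first≮last = subst₂ _<_ (sym first) (sym last) (≤∧≢⇒< (≮⇒≥ first≮last) ends-differ)

IsPerm? : {n : ℕ} → Decidable (IsPerm {n})
IsPerm? σ = map′ (λ inj {i} {j} → inj i j) (λ inj i j → inj)
  (all? λ i → all? λ j → (lookup σ i ≟ᶠ lookup σ j) →-dec (i ≟ᶠ j))

IsKing? : {n : ℕ} → Decidable (IsKing {n})
IsKing? {n} σ = map′ (λ king i 1≤i i<n → king i<n 1≤i) (λ king {i} i<n 1≤i → king i 1≤i i<n)
  (allUpTo? (λ i → (1 ≤? i) →-dec
    (¬? (val σ (suc i) ≟ suc (val σ i)) ×-dec ¬? (val σ i ≟ suc (val σ (suc i))))) n)

King? : (n : ℕ) → Decidable (King n)
King? n σ = IsPerm? σ ×-dec IsKing? σ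

theorem3p2 : (n : ℕ) → 2 ≤ n →
    Σ ℕ λ A →
      HasCard (King n) A ×
      HasCard (λ (σ : Vec (Fin n) n) → King n σ × Avoids σ) (A / 2) ×
      HasCard (λ (σ : Vec (Fin n) n) → King n σ × ExactlyOneOcc σ) (A / 2)
theorem3p2 n 1<n =
  half + half ,
  card ,
  subst (HasCard _) (sym ([m+m]/2≡m half)) (HasCard-resp avoiding card-¬Q) ,
  subst (HasCard _) (sym ([m+m]/2≡m half)) (HasCard-resp occurring-once card-Q)
  where
  open Halving (vectors-unique (Unique.allFin⁺ n) n) (∈-vectors ∈-allFin)
               (King? n) FirstBelowLast? reverse reverse-involutive reverse-King
               (λ (perm , _) → reverse-FirstBelowLast _ perm 1<n)
  avoiding : ∀ σ → (King n σ × ¬ FirstBelowLast σ) ⇔ (King n σ × Avoids σ)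
  avoiding σ = ×-⇔-under λ (perm , _) → ⇔-sym (Avoids⇔¬FirstBelowLast σ perm 1<n)
  occurring-once : ∀ σ → (King n σ × FirstBelowLast σ) ⇔ (King n σ × ExactlyOneOcc σ)
  occurring-once σ = ×-⇔-under λ (perm , _) → ⇔-sym (ExactlyOneOcc⇔FirstBelowLast σ perm 1<n)
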